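{- Let $n\ge3$ and let $u,v$ be independent, each uniformly distributed on $\mathcal B_n$. Then \[\max_{1\le i\le n+1}\mathbb E[Y_i(u,v)]=\mathbb E[Y_n(u,v)]=n+1-2\cdot\frac{F_{2n-3}}{F_{2n-1}}.\] In particular $\max_{1\le i\le n+1}\mathbb E[Y_i(u,v)]=n+O(1)$.
   Context: $\mathcal B_n$ is the set of Boolean permutations in $S_n$ (expressible as a product of simple transpositions $s_i=(i\ i{+}1)$ with no $s_i$ repeated). View $w\in S_n$ as a permutation of the positive integers fixing every $j>n$. For $j\ge1$, $\chi_j(w)=1$ if there exists $k<j$ with $w(k)>w(j)$, else $0$; $\Lambda_i(w)=\sum_{j\ge i}\chi_j(w)$; $Y_i(u,v)=\Lambda_i(u)+\Lambda_i(v)+i-1$. $F_m$ is the Fibonacci sequence with $F_1=F_2=1$. -}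

module Defs where

open import Data.Nat using (ℕ; zero; suc; _+_; _*_; _∸_; _≤_; _<_; _<?_; _≟_)
open import Data.Bool using (Bool; true; false; if_then_else_)
open import Data.List using (List; []; _∷_; map; upTo; filter; length)
open import Data.Nat.ListAction using (sum)
open import Data.List.Relation.Unary.Any using (any?)
open import Data.List.Relation.Unary.All using (All)
open import Data.List.Relation.Unary.Unique.Propositional using (Unique)
open import Data.Product using (Σ; _×_)
open import Relation.Binary.PropositionalEquality using (_≡_)
open import Relation.Nullary.Decidable using (does; ⌊_⌋)

F : ℕ → ℕ
F zero = zero
F (suc zero) = suc zero
F (suc (suc m)) = F (suc m) + F m

-- [a, a+1, ..., b]  (empty if b < a)
range : ℕ → ℕ → List ℕ
range a b = map (a +_) (upTo (suc b ∸ a))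

swap : ℕ → ℕ → ℕ
swap i j = if does (j ≟ i) then suc i else (if does (j ≟ suc i) then i else j)

applyWord : List ℕ → ℕ → ℕ
applyWord [] j = j
applyWord (i ∷ is) j = swap i (applyWord is j)

-- A permutation w ∈ S_n is represented by its one-line notation [w(1), ..., w(n)].
-- Value of w at a positive integer j; w fixes every j > n.
nth : List ℕ → ℕ → ℕ → ℕ
nth [] k d = d
nth (x ∷ xs) zero d = x
nth (x ∷ xs) (suc k) d = nth xs k d

val : List ℕ → ℕ → ℕ
val w j = nth w (j ∸ 1) j

IsBoolean : ℕ → List ℕ → Set
IsBoolean n w = Σ (List ℕ) λ ws →
  Unique ws × All (λ i → 1 ≤ i × i < n) ws × (w ≡ map (applyWord ws) (range 1 n))

χ : List ℕ → ℕ → ℕ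
χ w j = if ⌊ any? (λ k → val w j <? val w k) (range 1 (j ∸ 1)) ⌋ then 1 else 0

-- Λ_i(w) = Σ_{j ≥ i} χ_j(w), for w ∈ S_n.  Since χ_j(w) = 0 for j > n
-- (w fixes all j > n), the sum is over i ≤ j ≤ n.
Λ : ℕ → List ℕ → ℕ → ℕ
Λ n w i = sum (map (χ w) (range i n))

Y : ℕ → ℕ → List ℕ → List ℕ → ℕ
Y n i u v = Λ n u i + Λ n v i + i ∸ 1

-- Σ_{u ∈ L} Σ_{v ∈ L} Y_i(u,v)   (|L|^2 · E[Y_i] when L enumerates B_n)
SumY : ℕ → List (List ℕ) → ℕ → ℕ
SumY n L i = sum (map (λ u → sum (map (λ v → Y n i u v) L)) L)

-- Boolean permutations of S_{N+1} come in three disjoint families: those of S_N, the products w s_N with w ∈ B_N, and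
-- the products s_N w with w ∈ B_N whose word uses s_{N-1}.  Hence |B_n| = F_{2n-1}, and the column sums
-- c_j = Σ_{w ∈ B_n} χ_j(w) obey linear recurrences giving 2 c_j ≤ |B_n| for j < n and c_n = F_{2n-2}.  With N = |B_n|,
-- Σ_{u,v} Y_i(u,v) = N (2 Σ_{j ≥ i} c_j + N (i - 1)); passing from i to i + 1 adds N (N - 2 c_i), which is ≥ 0 for i < n
-- and ≤ 0 for i = n, and at i = n the sum is N (2 F_{2n-2} + N (n - 1)) = N² (n + 1 - 2 F_{2n-3} / F_{2n-1}).

module Submission where

open import Defs
open import Data.Nat using (ℕ; zero; suc; _+_; _*_; _∸_; _≤_; _<_; _≟_; _<?_; z≤n; s≤s)
open import Data.Nat.Properties
open import Data.Bool using (if_then_else_)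
open import Data.List using (List; []; _∷_; _++_; map; length; upTo; applyUpTo)
open import Data.List.Properties using (map-∘; map-upTo; map-cong; map-cong-local; map-++; length-map; length-++)
open import Data.Nat.ListAction using (sum)
open import Data.Nat.ListAction.Properties using (sum-++; sum-↭)
open import Data.Nat.Tactic.RingSolver using (solve-∀)
open import Data.List.Relation.Binary.Permutation.Propositional using (_↭_)
import Data.List.Relation.Binary.Permutation.Propositional.Properties as ↭
open import Data.List.Membership.Propositional.Properties.WithK using (unique∧set⇒bag)
open import Data.List.Relation.Binary.BagAndSetEquality using (∼bag⇒↭)
open import Data.List.Membership.Propositional using (_∈_; _∉_; find; lose)
open import Data.List.Membership.Propositional.Properties
  using (∈-map⁻; ∈-map⁺; ∈-upTo⁻; ∈-upTo⁺; ∈-++⁺ˡ; ∈-++⁺ʳ; ∈-∃++)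
open import Data.List.Membership.DecPropositional _≟_ using (_∈?_)
open import Data.List.Relation.Unary.Any using (Any; here; there; any?)
open import Data.List.Relation.Unary.All as All using (All; []; _∷_)
import Data.List.Relation.Unary.All.Properties as Allₚ
open import Data.List.Relation.Unary.Unique.Propositional using (Unique; []; _∷_)
import Data.List.Relation.Unary.Unique.Propositional.Properties as Unique
open import Data.List.Relation.Binary.Disjoint.Propositional using (Disjoint)
open import Data.Empty using (⊥)
open import Data.Product using (_×_; _,_; proj₁; proj₂)
open import Data.Sum using (inj₁; inj₂)
open import Relation.Binary.Definitions using (tri<; tri≈; tri>)
open import Function using (_∘_)
open import Function.Bundles using (_⇔_; mk⇔; Equivalence)
import Function.Properties.Equivalence as ⇔
open import Relation.Nullary using (¬_; Dec; yes; no; contradiction)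
open import Relation.Nullary.Decidable using (isYes; does; isYes≗does; dec-true; dec-false; does-⇔)
open import Relation.Binary.PropositionalEquality

private
  variable
    A B : Set

Unique-map⁺-on : ∀ {P : A → Set} {f : A → B} {xs} → All P xs → (∀ {x y} → P x → P y → f x ≡ f y → x ≡ y) →
                 Unique xs → Unique (map f xs)
Unique-map⁺-on []         _   []         = []
Unique-map⁺-on (px ∷ pxs) inj (x∉ ∷ uxs) =
  Allₚ.map⁺ (All.zipWith (λ (py , x≢y) fx≡fy → x≢y (inj px py fx≡fy)) (pxs , x∉)) ∷ Unique-map⁺-on pxs inj uxs

disjoint-by : ∀ {P Q : A → Set} {xs ys} → All P xs → All Q ys → (∀ {v} → P v → Q v → ⊥) → Disjoint xs ys
disjoint-by pxs qys P∩Q=∅ (v∈xs , v∈ys) = P∩Q=∅ (All.lookup pxs v∈xs) (All.lookup qys v∈ys)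

All-remove : ∀ {P : A → Set} as {x bs} → All P (as ++ x ∷ bs) → P x × All P (as ++ bs)
All-remove as ps with pas , px ∷ pbs ← Allₚ.++⁻ as ps = px , Allₚ.++⁺ pas pbs

Unique-remove : ∀ as {x : A} {bs} → Unique (as ++ x ∷ bs) → x ∉ as ++ bs × Unique (as ++ bs)
Unique-remove []       (x∉bs ∷ ubs) = Allₚ.All¬⇒¬Any x∉bs , ubs
Unique-remove (a ∷ as) (a∉ ∷ u) =
  let a≢x , a∉′ = All-remove as a∉ ; x∉ , u′ = Unique-remove as u in
  (λ { (here x≡a) → a≢x (sym x≡a) ; (there x∈) → x∉ x∈ }) , a∉′ ∷ u′

Unique-++-disjoint : ∀ as {bs} {x : A} → Unique (as ++ bs) → x ∈ bs → x ∉ as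
Unique-++-disjoint (a ∷ as) (a∉ ∷ _) x∈bs (here refl)  = All.lookup a∉ (∈-++⁺ʳ as x∈bs) refl
Unique-++-disjoint (a ∷ as) (_ ∷ u)  x∈bs (there x∈as) = Unique-++-disjoint as u x∈bs x∈as

sum-map-++ : ∀ (f : A → ℕ) xs ys → sum (map f (xs ++ ys)) ≡ sum (map f xs) + sum (map f ys)
sum-map-++ f xs ys = trans (cong sum (map-++ f xs ys)) (sum-++ (map f xs) (map f ys))

sum-map-cong-on : ∀ {f g : A → ℕ} {xs} → All (λ x → f x ≡ g x) xs → sum (map f xs) ≡ sum (map g xs)
sum-map-cong-on f≗g = cong sum (map-cong-local f≗g)

sum-map-const : ∀ c (xs : List A) → sum (map (λ _ → c) xs) ≡ length xs * c
sum-map-const c []       = refl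
sum-map-const c (x ∷ xs) = cong (c +_) (sum-map-const c xs)

sum-map-+ : ∀ (f g : A → ℕ) xs → sum (map (λ x → f x + g x) xs) ≡ sum (map f xs) + sum (map g xs)
sum-map-+ f g []       = refl
sum-map-+ f g (x ∷ xs) = trans (cong (f x + g x +_) (sum-map-+ f g xs)) (+-+-comm (f x) (g x) _ _)
  where +-+-comm : ∀ a b c d → a + b + (c + d) ≡ a + c + (b + d)
        +-+-comm = solve-∀

sum-map-*ˡ : ∀ k (f : A → ℕ) xs → sum (map (λ x → k * f x) xs) ≡ k * sum (map f xs)
sum-map-*ˡ k f []       = sym (*-zeroʳ k)
sum-map-*ˡ k f (x ∷ xs) = trans (cong (k * f x +_) (sum-map-*ˡ k f xs)) (sym (*-distribˡ-+ k (f x) _))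

sum-map-comm : ∀ (h : A → B → ℕ) xs ys →
               sum (map (λ x → sum (map (h x) ys)) xs) ≡ sum (map (λ y → sum (map (λ x → h x y) xs)) ys)
sum-map-comm h []       ys = sym (trans (sum-map-const 0 ys) (*-zeroʳ (length ys)))
sum-map-comm h (x ∷ xs) ys = trans (cong (sum (map (h x) ys) +_) (sum-map-comm h xs ys))
                                   (sym (sum-map-+ (h x) (λ y → sum (map (λ x → h x y) xs)) ys))

sum-pairs : ∀ (g : A → ℕ) c xs →
            sum (map (λ u → sum (map (λ v → g u + g v + c) xs)) xs) ≡ length xs * (2 * sum (map g xs) + length xs * c)
sum-pairs g c xs = begin
  sum (map (λ u → sum (map (λ v → g u + g v + c) xs)) xs)  ≡⟨ cong sum (map-cong inner xs) ⟩
  sum (map (λ u → N * g u + (s + N * c)) xs)              ≡⟨ sum-map-+ (λ u → N * g u) (λ _ → s + N * c) xs ⟩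
  sum (map (λ u → N * g u) xs) + sum (map (λ _ → s + N * c) xs)
    ≡⟨ cong₂ _+_ (sum-map-*ˡ N g xs) (sum-map-const (s + N * c) xs) ⟩
  N * s + N * (s + N * c)                                 ≡⟨ arith N s c ⟩
  N * (2 * s + N * c)                                     ∎
  where
  open ≡-Reasoning
  N = length xs
  s = sum (map g xs)
  arith : ∀ N s c → N * s + N * (s + N * c) ≡ N * (2 * s + N * c)
  arith = solve-∀
  inner : ∀ u → sum (map (λ v → g u + g v + c) xs) ≡ N * g u + (s + N * c)
  inner u = begin
    sum (map (λ v → g u + g v + c) xs)                         ≡⟨ sum-map-+ (λ v → g u + g v) (λ _ → c) xs ⟩
    sum (map (λ v → g u + g v) xs) + sum (map (λ _ → c) xs)
      ≡⟨ cong₂ _+_ (sum-map-+ (λ _ → g u) g xs) (sum-map-const c xs) ⟩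
    sum (map (λ _ → g u) xs) + s + N * c                       ≡⟨ cong (λ t → t + s + N * c) (sum-map-const (g u) xs) ⟩
    N * g u + s + N * c                                        ≡⟨ +-assoc (N * g u) s (N * c) ⟩
    N * g u + (s + N * c)                                      ∎

stepwise-≤ : ∀ (f : ℕ → ℕ) {m} → (∀ {i} → i < m → f i ≤ f (suc i)) → ∀ {i} → i ≤ m → f i ≤ f m
stepwise-≤ f {zero}  step z≤n = ≤-refl
stepwise-≤ f {suc m} step i≤1+m with m≤n⇒m<n∨m≡n i≤1+m
... | inj₁ i<1+m = ≤-trans (stepwise-≤ f (step ∘ m<n⇒m<1+n) (≤-pred i<1+m)) (step ≤-refl)
... | inj₂ refl  = ≤-refl

nth-applyUpTo : ∀ (g : ℕ → ℕ) {n k} d → k < n → nth (applyUpTo g n) k d ≡ g k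
nth-applyUpTo g {suc n} {zero}  d _         = refl
nth-applyUpTo g {suc n} {suc k} d (s≤s k<n) = nth-applyUpTo (g ∘ suc) d k<n

nth-applyUpTo-≥ : ∀ (g : ℕ → ℕ) {n k} d → n ≤ k → nth (applyUpTo g n) k d ≡ d
nth-applyUpTo-≥ g {zero}          d _         = refl
nth-applyUpTo-≥ g {suc n} {suc k} d (s≤s n≤k) = nth-applyUpTo-≥ (g ∘ suc) d n≤k

range-cons : ∀ {i n} → i ≤ n → range i n ≡ i ∷ range (suc i) n
range-cons {i} {n} i≤n = begin
  map (i +_) (upTo (suc n ∸ i))                ≡⟨ cong (map (i +_) ∘ upTo) (+-∸-assoc 1 i≤n) ⟩
  i + 0 ∷ map (i +_) (applyUpTo suc (n ∸ i))   ≡⟨ cong₂ _∷_ (+-identityʳ i) shift ⟩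
  i ∷ map (suc i +_) (upTo (n ∸ i))            ∎
  where
  open ≡-Reasoning
  shift : map (i +_) (applyUpTo suc (n ∸ i)) ≡ map (suc i +_) (upTo (n ∸ i))
  shift = begin
    map (i +_) (applyUpTo suc (n ∸ i))     ≡⟨ cong (map (i +_)) (map-upTo suc (n ∸ i)) ⟨
    map (i +_) (map suc (upTo (n ∸ i)))    ≡⟨ map-∘ (upTo (n ∸ i)) ⟨
    map ((i +_) ∘ suc) (upTo (n ∸ i))      ≡⟨ map-cong (+-suc i) (upTo (n ∸ i)) ⟩
    map (suc i +_) (upTo (n ∸ i))          ∎

range-empty : ∀ n → range (suc n) n ≡ []
range-empty n = cong (map (suc n +_) ∘ upTo) (n∸n≡0 n)

range-before⁻ : ∀ {j k} → k ∈ range 1 (j ∸ 1) → 1 ≤ k × k < j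
range-before⁻ {zero} ()
range-before⁻ {suc j} k∈ with k′ , k′∈ , refl ← ∈-map⁻ suc k∈ = s≤s z≤n , s≤s (∈-upTo⁻ k′∈)

range-before⁺ : ∀ {j k} → 1 ≤ k → k < j → k ∈ range 1 (j ∸ 1)
range-before⁺ {suc j} {suc k} _ (s≤s k<j) = ∈-map⁺ suc (∈-upTo⁺ k<j)

swap-self : ∀ i → swap i i ≡ suc i
swap-self i rewrite dec-true (i ≟ i) refl = refl

swap-suc : ∀ i → swap i (suc i) ≡ i
swap-suc i rewrite dec-false (suc i ≟ i) 1+n≢n | dec-true (suc i ≟ suc i) refl = refl

swap-fixed : ∀ {i j} → j ≢ i → j ≢ suc i → swap i j ≡ j
swap-fixed {i} {j} j≢i j≢1+i rewrite dec-false (j ≟ i) j≢i | dec-false (j ≟ suc i) j≢1+i = refl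

swap-below : ∀ {i j} → j < i → swap i j ≡ j
swap-below j<i = swap-fixed (<⇒≢ j<i) (<⇒≢ (m<n⇒m<1+n j<i))

swap-above : ∀ {i j} → suc i < j → swap i j ≡ j
swap-above 1+i<j = swap-fixed (>⇒≢ (<-trans (n<1+n _) 1+i<j)) (>⇒≢ 1+i<j)

data SwapView (i j : ℕ) : Set where
  at-self : j ≡ i → SwapView i j
  at-suc  : j ≡ suc i → SwapView i j
  fixed   : j ≢ i → j ≢ suc i → SwapView i j

swapView : ∀ i j → SwapView i j
swapView i j with j ≟ i | j ≟ suc i
... | yes j≡i | _         = at-self j≡i
... | no _    | yes j≡1+i = at-suc j≡1+i
... | no j≢i  | no j≢1+i  = fixed j≢i j≢1+i

swap-involutive : ∀ i j → swap i (swap i j) ≡ j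
swap-involutive i j with swapView i j
... | at-self refl    = trans (cong (swap i) (swap-self i)) (swap-suc i)
... | at-suc refl     = trans (cong (swap i) (swap-suc i)) (swap-self i)
... | fixed j≢i j≢1+i = trans (cong (swap i) (swap-fixed j≢i j≢1+i)) (swap-fixed j≢i j≢1+i)

swap-injective : ∀ i {x y} → swap i x ≡ swap i y → x ≡ y
swap-injective i {x} {y} eq = begin
  x                    ≡⟨ swap-involutive i x ⟨
  swap i (swap i x)    ≡⟨ cong (swap i) eq ⟩
  swap i (swap i y)    ≡⟨ swap-involutive i y ⟩
  y                    ∎
  where open ≡-Reasoning

swap-comm : ∀ {i k} → suc i < k → ∀ j → swap i (swap k j) ≡ swap k (swap i j)
swap-comm {i} {k} 1+i<k j with swapView k j
... | at-self j≡k rewrite j≡k = begin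
  swap i (swap k k)     ≡⟨ cong (swap i) (swap-self k) ⟩
  swap i (suc k)        ≡⟨ swap-above (m<n⇒m<1+n 1+i<k) ⟩
  suc k                 ≡⟨ swap-self k ⟨
  swap k k              ≡⟨ cong (swap k) (swap-above 1+i<k) ⟨
  swap k (swap i k)     ∎
  where open ≡-Reasoning
... | at-suc j≡1+k rewrite j≡1+k = begin
  swap i (swap k (suc k))  ≡⟨ cong (swap i) (swap-suc k) ⟩
  swap i k                 ≡⟨ swap-above 1+i<k ⟩
  k                        ≡⟨ swap-suc k ⟨
  swap k (suc k)           ≡⟨ cong (swap k) (swap-above (m<n⇒m<1+n 1+i<k)) ⟨
  swap k (swap i (suc k))  ∎
  where open ≡-Reasoning
... | fixed j≢k j≢1+k = trans (cong (swap i) (swap-fixed j≢k j≢1+k)) (sym (k-fixes (swapView i j)))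
  where
  k-fixes : SwapView i j → swap k (swap i j) ≡ swap i j
  k-fixes (at-self j≡i) rewrite j≡i | swap-self i = swap-below 1+i<k
  k-fixes (at-suc j≡1+i) rewrite j≡1+i | swap-suc i = swap-below (<-trans (n<1+n i) 1+i<k)
  k-fixes (fixed j≢i j≢1+i) rewrite swap-fixed j≢i j≢1+i = swap-fixed j≢k j≢1+k

swap-≤ : ∀ {N x} → x ≤ suc N → swap N x ≤ suc N
swap-≤ {N} {x} x≤1+N with swapView N x
... | at-self x≡N rewrite x≡N | swap-self N = ≤-refl
... | at-suc x≡1+N rewrite x≡1+N | swap-suc N = n≤1+n N
... | fixed x≢N x≢1+N rewrite swap-fixed x≢N x≢1+N = x≤1+N

swap-positive : ∀ {N x} → 1 ≤ N → 1 ≤ x → 1 ≤ swap N x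
swap-positive {N} {x} 1≤N 1≤x with swapView N x
... | at-self x≡N rewrite x≡N | swap-self N = s≤s z≤n
... | at-suc x≡1+N rewrite x≡1+N | swap-suc N = 1≤N
... | fixed x≢N x≢1+N rewrite swap-fixed x≢N x≢1+N = 1≤x

swap-inflationary : ∀ {N x} → x ≤ N → x ≤ swap N x
swap-inflationary {N} {x} x≤N with m≤n⇒m<n∨m≡n x≤N
... | inj₁ x<N = ≤-reflexive (sym (swap-below x<N))
... | inj₂ refl = ≤-trans (n≤1+n x) (≤-reflexive (sym (swap-self x)))

swap-monotone : ∀ {N x y} → x < y → y ≤ N → swap N x < swap N y
swap-monotone {N} x<y y≤N =
  subst (_< _) (sym (swap-below (<-≤-trans x<y y≤N))) (<-≤-trans x<y (swap-inflationary y≤N))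

swap-reflects-< : ∀ {N x y} → x ≤ N → swap N x < swap N y → x < y
swap-reflects-< {N} {x} {y} x≤N sx<sy with <-cmp x y
... | tri< x<y _ _ = x<y
... | tri≈ _ refl _ = contradiction sx<sy (<-irrefl refl)
... | tri> _ _ y<x = contradiction (swap-monotone y<x x≤N) (<⇒≯ sx<sy)

swap-<-⇔ : ∀ {N x y} → x ≤ N → y ≤ N → x < y ⇔ swap N x < swap N y
swap-<-⇔ x≤N y≤N = mk⇔ (λ x<y → swap-monotone x<y y≤N) (swap-reflects-< x≤N)

oneLine : ℕ → (ℕ → ℕ) → List ℕ
oneLine n f = map f (range 1 n)

oneLine-applyUpTo : ∀ n f → oneLine n f ≡ applyUpTo (f ∘ suc) n
oneLine-applyUpTo n f = trans (sym (map-∘ (upTo n))) (map-upTo (f ∘ suc) n)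

val-oneLine : ∀ {n} f {j} → 1 ≤ j → j ≤ n → val (oneLine n f) j ≡ f j
val-oneLine {n} f {suc j} _ j<n rewrite oneLine-applyUpTo n f = nth-applyUpTo (f ∘ suc) (suc j) j<n

val-oneLine-> : ∀ {n} f {j} → n < j → val (oneLine n f) j ≡ j
val-oneLine-> {n} f {suc j} (s≤s n≤j) rewrite oneLine-applyUpTo n f = nth-applyUpTo-≥ (f ∘ suc) (suc j) n≤j

val-oneLine-fixing : ∀ {n} f → (∀ {j} → n < j → f j ≡ j) → ∀ {j} → 1 ≤ j → val (oneLine n f) j ≡ f j
val-oneLine-fixing {n} f fixes {j} 1≤j with j ≤? n
... | yes j≤n = val-oneLine f 1≤j j≤n
... | no j≰n  = trans (val-oneLine-> f (≰⇒> j≰n)) (sym (fixes (≰⇒> j≰n)))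

oneLine-cong : ∀ {n} {f g : ℕ → ℕ} → (∀ {j} → 1 ≤ j → j ≤ n → f j ≡ g j) → oneLine n f ≡ oneLine n g
oneLine-cong {f = f} {g} f≗g = map-cong-local (All.tabulate λ j∈ →
  let k , k∈ , j≡1+k = ∈-map⁻ suc j∈ in
  subst (λ j → f j ≡ g j) (sym j≡1+k) (f≗g (s≤s z≤n) (∈-upTo⁻ k∈)))

oneLine-val : ∀ n f → oneLine n (val (oneLine n f)) ≡ oneLine n f
oneLine-val n f = oneLine-cong (val-oneLine f)

oneLine-injective : ∀ {n f g} → oneLine n f ≡ oneLine n g → ∀ {j} → 1 ≤ j → j ≤ n → f j ≡ g j
oneLine-injective {f = f} {g} eq {j} 1≤j j≤n =
  trans (sym (val-oneLine f 1≤j j≤n)) (trans (cong (λ u → val u j) eq) (val-oneLine g 1≤j j≤n))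

largerBefore? : ∀ w j → Dec (Any (λ k → val w j < val w k) (range 1 (j ∸ 1)))
largerBefore? w j = any? (λ k → val w j <? val w k) (range 1 (j ∸ 1))

χ-≡1 : ∀ {w j} k → 1 ≤ k → k < j → val w j < val w k → χ w j ≡ 1
χ-≡1 {w} {j} k 1≤k k<j larger = cong (λ b → if b then 1 else 0)
  (trans (isYes≗does (largerBefore? w j))
         (dec-true (largerBefore? w j) (lose {P = λ k → val w j < val w k} (range-before⁺ 1≤k k<j) larger)))

χ-≡0 : ∀ {w j} → (∀ {k} → 1 ≤ k → k < j → val w k ≤ val w j) → χ w j ≡ 0
χ-≡0 {w} {j} maximal = cong (λ b → if b then 1 else 0)
  (trans (isYes≗does (largerBefore? w j)) (dec-false (largerBefore? w j) no-larger))
  where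
  no-larger : ¬ Any (λ k → val w j < val w k) (range 1 (j ∸ 1))
  no-larger larger with k , k∈ , larger-k ← find larger =
    let 1≤k , k<j = range-before⁻ k∈ in <⇒≱ larger-k (maximal 1≤k k<j)

χ-cong : ∀ {w w′ j} → (∀ {k} → 1 ≤ k → k < j → val w j < val w k ⇔ val w′ j < val w′ k) → χ w j ≡ χ w′ j
χ-cong {w} {w′} {j} same-order =
  cong (λ b → if b then 1 else 0) (begin
    isYes (largerBefore? w j)   ≡⟨ isYes≗does _ ⟩
    does (largerBefore? w j)
      ≡⟨ does-⇔ (mk⇔ (transport to) (transport from)) (largerBefore? w j) (largerBefore? w′ j) ⟩
    does (largerBefore? w′ j)   ≡⟨ isYes≗does _ ⟨
    isYes (largerBefore? w′ j)  ∎)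
  where
  open Equivalence
  open ≡-Reasoning
  transport : ∀ {P Q : ℕ → Set} → (∀ {k} → (val w j < val w k ⇔ val w′ j < val w′ k) → P k → Q k) →
              Any P (range 1 (j ∸ 1)) → Any Q (range 1 (j ∸ 1))
  transport move any with k , k∈ , pk ← find any =
    let 1≤k , k<j = range-before⁻ k∈ in lose k∈ (move (same-order 1≤k k<j) pk)

χ-cong-≡ : ∀ {w w′ j} → (∀ {k} → 1 ≤ k → k ≤ j → val w k ≡ val w′ k) → χ w j ≡ χ w′ j
χ-cong-≡ {w} {w′} same = χ-cong {w} {w′} λ 1≤k k<j →
  let eqʲ = same (≤-trans 1≤k (<⇒≤ k<j)) ≤-refl ; eqᵏ = same 1≤k (<⇒≤ k<j) in
  mk⇔ (subst₂ _<_ eqʲ eqᵏ) (subst₂ _<_ (sym eqʲ) (sym eqᵏ))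

applyWord-++ : ∀ as bs j → applyWord (as ++ bs) j ≡ applyWord as (applyWord bs j)
applyWord-++ []       bs j = refl
applyWord-++ (i ∷ as) bs j = cong (swap i) (applyWord-++ as bs j)

applyWord-fixes : ∀ {N ws} → All (_< N) ws → ∀ {j} → N < j → applyWord ws j ≡ j
applyWord-fixes []           N<j = refl
applyWord-fixes {ws = i ∷ _} (i<N ∷ ws<N) N<j =
  trans (cong (swap i) (applyWord-fixes ws<N N<j)) (swap-above (≤-<-trans i<N N<j))

applyWord-swap-comm : ∀ {k ws} → All (λ i → suc i < k) ws → ∀ j → applyWord ws (swap k j) ≡ swap k (applyWord ws j)
applyWord-swap-comm []             j = refl
applyWord-swap-comm {ws = i ∷ ws} (1+i<k ∷ far) j =
  trans (cong (swap i) (applyWord-swap-comm far j)) (swap-comm 1+i<k (applyWord ws j))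

applyWord-pull-front : ∀ {k} as bs → All (λ i → suc i < k) as →
                       ∀ j → applyWord (as ++ k ∷ bs) j ≡ applyWord (k ∷ as ++ bs) j
applyWord-pull-front {k} as bs far j = begin
  applyWord (as ++ k ∷ bs) j              ≡⟨ applyWord-++ as (k ∷ bs) j ⟩
  applyWord as (swap k (applyWord bs j))  ≡⟨ applyWord-swap-comm far (applyWord bs j) ⟩
  swap k (applyWord as (applyWord bs j))  ≡⟨ cong (swap k) (applyWord-++ as bs j) ⟨
  swap k (applyWord (as ++ bs) j)         ∎
  where open ≡-Reasoning

applyWord-push-back : ∀ {k} as bs → All (λ i → suc i < k) bs →
                      ∀ j → applyWord (as ++ k ∷ bs) j ≡ applyWord ((as ++ bs) ++ k ∷ []) j
applyWord-push-back {k} as bs far j = begin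
  applyWord (as ++ k ∷ bs) j              ≡⟨ applyWord-++ as (k ∷ bs) j ⟩
  applyWord as (swap k (applyWord bs j))  ≡⟨ cong (applyWord as) (applyWord-swap-comm far j) ⟨
  applyWord as (applyWord bs (swap k j))  ≡⟨ applyWord-++ as bs (swap k j) ⟨
  applyWord (as ++ bs) (swap k j)         ≡⟨ applyWord-++ (as ++ bs) (k ∷ []) j ⟨
  applyWord ((as ++ bs) ++ k ∷ []) j      ∎
  where open ≡-Reasoning

Generator : ℕ → ℕ → Set
Generator n i = 1 ≤ i × i < n

Generator-weaken : ∀ {N i} → Generator N i → Generator (suc N) i
Generator-weaken (1≤i , i<N) = 1≤i , m<n⇒m<1+n i<N

Generator-shrink : ∀ {N xs} → All (Generator (suc N)) xs → N ∉ xs → All (Generator N) xs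
Generator-shrink {N} {xs} gens N∉xs = All.tabulate λ {i} i∈xs →
  let 1≤i , i<1+N = All.lookup gens i∈xs in
  1≤i , ≤∧≢⇒< (≤-pred i<1+N) (λ i≡N → N∉xs (subst (_∈ xs) i≡N i∈xs))

val-word : ∀ {N ws} → All (Generator N) ws → ∀ {j} → 1 ≤ j → val (oneLine N (applyWord ws)) j ≡ applyWord ws j
val-word {ws = ws} gens = val-oneLine-fixing (applyWord ws) (applyWord-fixes (All.map proj₂ gens))

Generator-distant : ∀ {m xs} → All (Generator (suc m)) xs → m ∉ xs → All (λ i → suc i < suc m) xs
Generator-distant gens m∉xs = All.map (λ (_ , i<m) → s≤s i<m) (Generator-shrink gens m∉xs)

record Fits (N : ℕ) (w : List ℕ) : Set where
  field
    shape   : w ≡ oneLine N (val w)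
    bounded : ∀ {j} → 1 ≤ j → j ≤ N → val w j ≤ N

  fixes : ∀ {j} → N < j → val w j ≡ j
  fixes {j} N<j = trans (cong (λ u → val u j) shape) (val-oneLine-> (val w) N<j)

  bounded-suc : ∀ {j} → 1 ≤ j → j ≤ suc N → val w j ≤ suc N
  bounded-suc {j} 1≤j j≤1+N with m≤n⇒m<n∨m≡n j≤1+N
  ... | inj₁ j<1+N = m≤n⇒m≤1+n (bounded 1≤j (≤-pred j<1+N))
  ... | inj₂ refl  = ≤-reflexive (fixes ≤-refl)

open Fits

fits-oneLine : ∀ {n f} → (∀ {j} → 1 ≤ j → j ≤ n → f j ≤ n) → Fits n (oneLine n f)
fits-oneLine {n} {f} f≤n = record
  { shape   = sym (oneLine-val n f)
  ; bounded = λ 1≤j j≤n → ≤-trans (≤-reflexive (val-oneLine f 1≤j j≤n)) (f≤n 1≤j j≤n) }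

fits-≡ : ∀ {N w w′} → Fits N w → Fits N w′ → (∀ {j} → 1 ≤ j → j ≤ N → val w j ≡ val w′ j) → w ≡ w′
fits-≡ fw fw′ w≗w′ = trans (shape fw) (trans (oneLine-cong w≗w′) (sym (shape fw′)))

record MovesLast (N : ℕ) (w : List ℕ) : Set where
  constructor movesLast
  field
    last-moved : val w N ≢ N
    source     : ℕ
    1≤source   : 1 ≤ source
    source<N   : source < N
    source↦N   : val w source ≡ N

open MovesLast

-- As permutations of {1, …, N+1}: w, w s_N and s_N w.
extend swapPositions swapValues : ℕ → List ℕ → List ℕ
extend N w        = oneLine (suc N) (val w)
swapPositions N w = oneLine (suc N) (val w ∘ swap N)
swapValues N w    = oneLine (suc N) (swap N ∘ val w)

module _ {N w} (fw : Fits N w) where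

  extend-fits : Fits (suc N) (extend N w)
  extend-fits = fits-oneLine (bounded-suc fw)

  extend-top : val (extend N w) (suc N) ≡ suc N
  extend-top = trans (val-oneLine (val w) (s≤s z≤n) ≤-refl) (fixes fw ≤-refl)

  χ-extend : ∀ {j} → j ≤ N → χ (extend N w) j ≡ χ w j
  χ-extend j≤N = χ-cong-≡ {extend N w} {w} λ 1≤k k≤j → val-oneLine (val w) 1≤k (m≤n⇒m≤1+n (≤-trans k≤j j≤N))

  χ-extend-top : χ (extend N w) (suc N) ≡ 0
  χ-extend-top = χ-≡0 {extend N w} λ 1≤k k<1+N → subst₂ _≤_
    (sym (val-oneLine (val w) 1≤k (<⇒≤ k<1+N))) (sym extend-top) (m≤n⇒m≤1+n (bounded fw 1≤k (≤-pred k<1+N)))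

  swapValues-fits : Fits (suc N) (swapValues N w)
  swapValues-fits = fits-oneLine λ 1≤j j≤1+N → swap-≤ (bounded-suc fw 1≤j j≤1+N)

  χ-swapValues : ∀ {j} → j ≤ N → χ (swapValues N w) j ≡ χ w j
  χ-swapValues {j} j≤N = χ-cong {swapValues N w} {w} λ {k} 1≤k k<j →
    let 1≤j = ≤-trans 1≤k (<⇒≤ k<j) ; k≤N = ≤-trans (<⇒≤ k<j) j≤N in
    subst₂ (λ a b → a < b ⇔ val w j < val w k)
      (sym (val-oneLine (swap N ∘ val w) 1≤j (m≤n⇒m≤1+n j≤N)))
      (sym (val-oneLine (swap N ∘ val w) 1≤k (m≤n⇒m≤1+n k≤N)))
      (⇔.sym (swap-<-⇔ (bounded fw 1≤j j≤N) (bounded fw 1≤k k≤N)))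

  module _ (1≤N : 1 ≤ N) where

    private
      val-swapPositions : ∀ {j} → 1 ≤ j → j ≤ suc N → val (swapPositions N w) j ≡ val w (swap N j)
      val-swapPositions = val-oneLine (val w ∘ swap N)

    swapPositions-fits : Fits (suc N) (swapPositions N w)
    swapPositions-fits = fits-oneLine λ 1≤j j≤1+N → bounded-suc fw (swap-positive 1≤N 1≤j) (swap-≤ j≤1+N)

    swapPositions-at-N : val (swapPositions N w) N ≡ suc N
    swapPositions-at-N = begin
      val (swapPositions N w) N  ≡⟨ val-swapPositions 1≤N (n≤1+n N) ⟩
      val w (swap N N)           ≡⟨ cong (val w) (swap-self N) ⟩
      val w (suc N)              ≡⟨ fixes fw ≤-refl ⟩
      suc N                      ∎
      where open ≡-Reasoning

    swapPositions-top : val (swapPositions N w) (suc N) ≡ val w N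
    swapPositions-top = trans (val-swapPositions (s≤s z≤n) ≤-refl) (cong (val w) (swap-suc N))

    swapPositions-moves : MovesLast (suc N) (swapPositions N w)
    swapPositions-moves = movesLast
      (λ top≡1+N → 1+n≰n (subst (_≤ N) (trans (sym swapPositions-top) top≡1+N) (bounded fw 1≤N ≤-refl)))
      N 1≤N (n<1+n N) swapPositions-at-N

    χ-swapPositions : ∀ {j} → j < N → χ (swapPositions N w) j ≡ χ w j
    χ-swapPositions j<N = χ-cong-≡ {swapPositions N w} {w} λ 1≤k k≤j →
      let k<N = ≤-<-trans k≤j j<N in
      trans (val-swapPositions 1≤k (m≤n⇒m≤1+n (<⇒≤ k<N))) (cong (val w) (swap-below k<N))

    χ-swapPositions-N : χ (swapPositions N w) N ≡ 0
    χ-swapPositions-N = χ-≡0 {swapPositions N w} λ 1≤k k<N → subst₂ _≤_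
      (sym (trans (val-swapPositions 1≤k (m≤n⇒m≤1+n (<⇒≤ k<N))) (cong (val w) (swap-below k<N))))
      (sym swapPositions-at-N)
      (m≤n⇒m≤1+n (bounded fw 1≤k (<⇒≤ k<N)))

    χ-swapPositions-top : χ (swapPositions N w) (suc N) ≡ 1
    χ-swapPositions-top = χ-≡1 {swapPositions N w} N 1≤N (n<1+n N)
      (subst₂ _<_ (sym swapPositions-top) (sym swapPositions-at-N) (s≤s (bounded fw 1≤N ≤-refl)))

  module _ (moves : MovesLast N w) where

    private
      val-swapValues : ∀ {j} → 1 ≤ j → j ≤ suc N → val (swapValues N w) j ≡ swap N (val w j)
      val-swapValues = val-oneLine (swap N ∘ val w)

      1≤N : 1 ≤ N
      1≤N = ≤-trans (1≤source moves) (<⇒≤ (source<N moves))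

      last<N : val w N < N
      last<N = ≤∧≢⇒< (bounded fw 1≤N ≤-refl) (last-moved moves)

      swapValues-top : val (swapValues N w) (suc N) ≡ N
      swapValues-top = begin
        val (swapValues N w) (suc N)  ≡⟨ val-swapValues (s≤s z≤n) ≤-refl ⟩
        swap N (val w (suc N))        ≡⟨ cong (swap N) (fixes fw ≤-refl) ⟩
        swap N (suc N)                ≡⟨ swap-suc N ⟩
        N                             ∎
        where open ≡-Reasoning

      swapValues-at-source : val (swapValues N w) (source moves) ≡ suc N
      swapValues-at-source = begin
        val (swapValues N w) (source moves)  ≡⟨ val-swapValues (1≤source moves) (m≤n⇒m≤1+n (<⇒≤ (source<N moves))) ⟩
        swap N (val w (source moves))        ≡⟨ cong (swap N) (source↦N moves) ⟩
        swap N N                             ≡⟨ swap-self N ⟩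
        suc N                                ∎
        where open ≡-Reasoning

    swapValues-at-N : val (swapValues N w) N < N
    swapValues-at-N = subst (_< N) (sym (trans (val-swapValues 1≤N (n≤1+n N)) (swap-below last<N))) last<N

    swapValues-moves : MovesLast (suc N) (swapValues N w)
    swapValues-moves = movesLast
      (λ top≡1+N → 1+n≢n (trans (sym top≡1+N) swapValues-top))
      (source moves) (1≤source moves) (m<n⇒m<1+n (source<N moves)) swapValues-at-source

    χ-swapValues-top : χ (swapValues N w) (suc N) ≡ 1
    χ-swapValues-top = χ-≡1 {swapValues N w} (source moves) (1≤source moves) (m<n⇒m<1+n (source<N moves))
      (subst₂ _<_ (sym swapValues-top) (sym swapValues-at-source) (n<1+n N))

extend-injective : ∀ {N w w′} → Fits N w → Fits N w′ → extend N w ≡ extend N w′ → w ≡ w′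
extend-injective fw fw′ eq = fits-≡ fw fw′ λ 1≤j j≤N → oneLine-injective eq 1≤j (m≤n⇒m≤1+n j≤N)

swapValues-injective : ∀ {N w w′} → Fits N w → Fits N w′ → swapValues N w ≡ swapValues N w′ → w ≡ w′
swapValues-injective {N} fw fw′ eq =
  fits-≡ fw fw′ λ 1≤j j≤N → swap-injective N (oneLine-injective eq 1≤j (m≤n⇒m≤1+n j≤N))

swapPositions-injective : ∀ {N w w′} → 1 ≤ N → Fits N w → Fits N w′ → swapPositions N w ≡ swapPositions N w′ → w ≡ w′
swapPositions-injective {N} {w} {w′} 1≤N fw fw′ eq = fits-≡ fw fw′ λ {j} 1≤j j≤N → begin
  val w j                     ≡⟨ cong (val w) (swap-involutive N j) ⟨
  val w (swap N (swap N j))   ≡⟨ oneLine-injective eq (swap-positive 1≤N 1≤j) (swap-≤ (m≤n⇒m≤1+n j≤N)) ⟩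
  val w′ (swap N (swap N j))  ≡⟨ cong (val w′) (swap-involutive N j) ⟩
  val w′ j                    ∎
  where open ≡-Reasoning

extend-word : ∀ {N ws} → All (Generator N) ws → extend N (oneLine N (applyWord ws)) ≡ oneLine (suc N) (applyWord ws)
extend-word gens = oneLine-cong λ 1≤j _ → val-word gens 1≤j

swapValues-word : ∀ {N ws} → All (Generator N) ws →
                  swapValues N (oneLine N (applyWord ws)) ≡ oneLine (suc N) (applyWord (N ∷ ws))
swapValues-word {N} gens = oneLine-cong λ 1≤j _ → cong (swap N) (val-word gens 1≤j)

swapPositions-word : ∀ {N ws} → 1 ≤ N → All (Generator N) ws →
                     swapPositions N (oneLine N (applyWord ws)) ≡ oneLine (suc N) (applyWord (ws ++ N ∷ []))
swapPositions-word {N} {ws} 1≤N gens = oneLine-cong λ {j} 1≤j _ →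
  trans (val-word gens (swap-positive 1≤N 1≤j)) (sym (applyWord-++ ws (N ∷ []) j))

module _ {N : ℕ} {w : List ℕ} where

  extend-boolean : IsBoolean N w → IsBoolean (suc N) (extend N w)
  extend-boolean (ws , uws , gens , refl) = ws , uws , All.map Generator-weaken gens , extend-word gens

  swapValues-boolean : 1 ≤ N → IsBoolean N w → IsBoolean (suc N) (swapValues N w)
  swapValues-boolean 1≤N (ws , uws , gens , refl) =
    N ∷ ws , All.map (λ (_ , i<N) → >⇒≢ i<N) gens ∷ uws ,
    (1≤N , n<1+n N) ∷ All.map Generator-weaken gens , swapValues-word gens

  swapPositions-boolean : 1 ≤ N → IsBoolean N w → IsBoolean (suc N) (swapPositions N w)
  swapPositions-boolean 1≤N (ws , uws , gens , refl) =
    ws ++ N ∷ [] , Unique.++⁺ uws ([] ∷ []) (λ { (N∈ws , here refl) → <-irrefl refl (proj₂ (All.lookup gens N∈ws)) }) ,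
    Allₚ.++⁺ (All.map Generator-weaken gens) ((1≤N , n<1+n N) ∷ []) , swapPositions-word 1≤N gens

-- booleans m lists B_{m+1}, and booleansMoving m those of its elements whose word uses s_m.  In a Boolean word using
-- s_N, the letter s_N commutes with everything after it unless s_{N-1} occurs there, and then with everything before it.
booleans booleansMoving : ℕ → List (List ℕ)
booleans zero          = (1 ∷ []) ∷ []
booleans (suc m)       = map (extend (suc m)) (booleans m) ++ booleansMoving (suc m)
booleansMoving zero    = []
booleansMoving (suc m) = map (swapPositions (suc m)) (booleans m) ++ map (swapValues (suc m)) (booleansMoving m)

booleans-fits : ∀ m → All (Fits (suc m)) (booleans m)
booleansMoving-fits : ∀ m → All (Fits (suc m)) (booleansMoving m)
booleans-fits zero          = fits-oneLine {f = λ j → j} (λ _ j≤1 → j≤1) ∷ []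
booleans-fits (suc m)       = Allₚ.++⁺ (Allₚ.map⁺ (All.map extend-fits (booleans-fits m))) (booleansMoving-fits (suc m))
booleansMoving-fits zero    = []
booleansMoving-fits (suc m) = Allₚ.++⁺
  (Allₚ.map⁺ (All.map (λ fw → swapPositions-fits fw (s≤s z≤n)) (booleans-fits m)))
  (Allₚ.map⁺ (All.map swapValues-fits (booleansMoving-fits m)))

booleansMoving-moves : ∀ m → All (MovesLast (suc m)) (booleansMoving m)
booleansMoving-moves zero    = []
booleansMoving-moves (suc m) = Allₚ.++⁺
  (Allₚ.map⁺ (All.map (λ fw → swapPositions-moves fw (s≤s z≤n)) (booleans-fits m)))
  (Allₚ.map⁺ (All.zipWith (λ (fw , moves) → swapValues-moves fw moves)
                          (booleansMoving-fits m , booleansMoving-moves m)))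

booleans-unique : ∀ m → Unique (booleans m)
booleansMoving-unique : ∀ m → Unique (booleansMoving m)
booleans-unique zero          = [] ∷ []
booleans-unique (suc m)       = Unique.++⁺
  (Unique-map⁺-on (booleans-fits m) extend-injective (booleans-unique m))
  (booleansMoving-unique (suc m))
  (disjoint-by {P = λ v → val v (suc (suc m)) ≡ suc (suc m)}
    (Allₚ.map⁺ (All.map extend-top (booleans-fits m)))
    (booleansMoving-moves (suc m))
    λ top≡ moves → last-moved moves top≡)
booleansMoving-unique zero    = []
booleansMoving-unique (suc m) = Unique.++⁺
  (Unique-map⁺-on (booleans-fits m) (swapPositions-injective (s≤s z≤n)) (booleans-unique m))
  (Unique-map⁺-on (booleansMoving-fits m) swapValues-injective (booleansMoving-unique m))
  (disjoint-by {P = λ v → val v (suc m) ≡ suc (suc m)} {Q = λ v → val v (suc m) < suc m}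
    (Allₚ.map⁺ (All.map (λ fw → swapPositions-at-N fw (s≤s z≤n)) (booleans-fits m)))
    (Allₚ.map⁺ (All.zipWith (λ (fw , moves) → swapValues-at-N fw moves)
                            (booleansMoving-fits m , booleansMoving-moves m)))
    λ at≡1+N at<N → <-irrefl at≡1+N (m<n⇒m<1+n at<N))

booleans-boolean : ∀ m → All (IsBoolean (suc m)) (booleans m)
booleansMoving-boolean : ∀ m → All (IsBoolean (suc m)) (booleansMoving m)
booleans-boolean zero          = ([] , [] , [] , refl) ∷ []
booleans-boolean (suc m)       =
  Allₚ.++⁺ (Allₚ.map⁺ (All.map extend-boolean (booleans-boolean m))) (booleansMoving-boolean (suc m))
booleansMoving-boolean zero    = []
booleansMoving-boolean (suc m) = Allₚ.++⁺
  (Allₚ.map⁺ (All.map (swapPositions-boolean (s≤s z≤n)) (booleans-boolean m)))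
  (Allₚ.map⁺ (All.map (swapValues-boolean (s≤s z≤n)) (booleansMoving-boolean m)))

booleans-complete : ∀ m {ws} → Unique ws → All (Generator (suc m)) ws →
  oneLine (suc m) (applyWord ws) ∈ booleans m × (m ∈ ws → oneLine (suc m) (applyWord ws) ∈ booleansMoving m)
booleansMoving-complete : ∀ m as {bs} → let ws = as ++ suc m ∷ bs in Unique ws → All (Generator (suc (suc m))) ws →
  oneLine (suc (suc m)) (applyWord ws) ∈ booleansMoving (suc m)

booleans-complete zero {[]}    _ []                = here refl , λ ()
booleans-complete zero {i ∷ _} _ ((1≤i , i<1) ∷ _) = contradiction 1≤i (<⇒≱ i<1)
booleans-complete (suc m) {ws} uws gens with suc m ∈? ws
... | yes N∈ws with as , bs , refl ← ∈-∃++ N∈ws =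
  let moving = booleansMoving-complete m as uws gens in
  ∈-++⁺ʳ (map (extend (suc m)) (booleans m)) moving , λ _ → moving
... | no N∉ws = ∈-++⁺ˡ (subst (_∈ map (extend (suc m)) (booleans m)) (extend-word gens′)
                  (∈-map⁺ (extend (suc m)) (proj₁ (booleans-complete m uws gens′))))
              , λ N∈ws → contradiction N∈ws N∉ws
  where gens′ = Generator-shrink gens N∉ws

booleansMoving-complete m as {bs} uws gens
  with N∉ , uws′ ← Unique-remove as uws | _ , gens″ ← All-remove as gens
  with gens′ ← Generator-shrink gens″ N∉ | m ∈? bs
... | yes m∈bs = ∈-++⁺ʳ (map (swapPositions N) (booleans m))
  (subst (_∈ map (swapValues N) (booleansMoving m)) swapValues-eq
    (∈-map⁺ (swapValues N) (proj₂ (booleans-complete m uws′ gens′) (∈-++⁺ʳ as m∈bs))))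
  where
  N = suc m
  swapValues-eq : swapValues N (oneLine N (applyWord (as ++ bs))) ≡ oneLine (suc N) (applyWord (as ++ N ∷ bs))
  swapValues-eq = trans (swapValues-word gens′) (oneLine-cong λ {j} _ _ → sym (applyWord-pull-front as bs
    (Generator-distant (proj₁ (Allₚ.++⁻ as gens′)) (Unique-++-disjoint as uws′ m∈bs)) j))
... | no m∉bs = ∈-++⁺ˡ
  (subst (_∈ map (swapPositions N) (booleans m)) swapPositions-eq
    (∈-map⁺ (swapPositions N) (proj₁ (booleans-complete m uws′ gens′))))
  where
  N = suc m
  swapPositions-eq : swapPositions N (oneLine N (applyWord (as ++ bs))) ≡ oneLine (suc N) (applyWord (as ++ N ∷ bs))
  swapPositions-eq = trans (swapPositions-word (s≤s z≤n) gens′) (oneLine-cong λ {j} _ _ → sym (applyWord-push-back as bs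
    (Generator-distant (proj₂ (Allₚ.++⁻ as gens′)) m∉bs) j))

booleans-↭ : ∀ m {L} → Unique L → (∀ w → (w ∈ L) ⇔ IsBoolean (suc m) w) → L ↭ booleans m
booleans-↭ m {L} uL L⇔B = ∼bag⇒↭ (unique∧set⇒bag uL (booleans-unique m) (λ {w} → mk⇔ (complete w) (sound w)))
  where
  open Equivalence
  complete : ∀ w → w ∈ L → w ∈ booleans m
  complete w w∈L with ws , uws , gens , refl ← to (L⇔B w) w∈L = proj₁ (booleans-complete m uws gens)
  sound : ∀ w → w ∈ booleans m → w ∈ L
  sound w w∈B = from (L⇔B w) (All.lookup (booleans-boolean m) w∈B)

length-booleans-suc : ∀ m → length (booleans (suc m)) ≡ length (booleans m) + length (booleansMoving (suc m))
length-booleans-suc m =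
  trans (length-++ (map (extend (suc m)) (booleans m))) (cong₂ _+_ (length-map (extend (suc m)) (booleans m)) refl)

length-booleansMoving-suc : ∀ m → length (booleansMoving (suc m)) ≡ length (booleans m) + length (booleansMoving m)
length-booleansMoving-suc m = trans (length-++ (map (swapPositions (suc m)) (booleans m)))
  (cong₂ _+_ (length-map (swapPositions (suc m)) (booleans m)) (length-map (swapValues (suc m)) (booleansMoving m)))

length-booleans-fib : ∀ m → length (booleans m) ≡ F (suc (2 * m)) × length (booleansMoving m) ≡ F (2 * m)
length-booleans-fib zero = refl , refl
length-booleans-fib (suc m) with b≡ , q≡ ← length-booleans-fib m = b′≡ , q′≡
  where
  open ≡-Reasoning
  q′≡ : length (booleansMoving (suc m)) ≡ F (2 * suc m)
  q′≡ = begin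
    length (booleansMoving (suc m))                  ≡⟨ length-booleansMoving-suc m ⟩
    length (booleans m) + length (booleansMoving m)  ≡⟨ cong₂ _+_ b≡ q≡ ⟩
    F (suc (suc (2 * m)))                            ≡⟨ cong F (*-suc 2 m) ⟨
    F (2 * suc m)                                    ∎
  b′≡ : length (booleans (suc m)) ≡ F (suc (2 * suc m))
  b′≡ = begin
    length (booleans (suc m))                        ≡⟨ length-booleans-suc m ⟩
    length (booleans m) + length (booleansMoving (suc m))  ≡⟨ cong₂ _+_ b≡ (trans q′≡ (cong F (*-suc 2 m))) ⟩
    F (suc (2 * m)) + F (suc (suc (2 * m)))          ≡⟨ +-comm (F (suc (2 * m))) _ ⟩
    F (suc (suc (suc (2 * m))))                      ≡⟨ cong (F ∘ suc) (*-suc 2 m) ⟨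
    F (suc (2 * suc m))                              ∎

Σχ : List (List ℕ) → ℕ → ℕ
Σχ X j = sum (map (λ w → χ w j) X)

module _ {f : List ℕ → List ℕ} {X : List (List ℕ)} {j : ℕ} where

  Σχ-map-preserving : All (λ w → χ (f w) j ≡ χ w j) X → Σχ (map f X) j ≡ Σχ X j
  Σχ-map-preserving χ-same = trans (cong sum (sym (map-∘ X))) (sum-map-cong-on χ-same)

  Σχ-map-const : ∀ {c} → All (λ w → χ (f w) j ≡ c) X → Σχ (map f X) j ≡ length X * c
  Σχ-map-const {c} χ-const = trans (cong sum (sym (map-∘ X))) (trans (sum-map-cong-on χ-const) (sum-map-const c X))

module _ (m : ℕ) where
  private
    N = suc m
    Bₘ = booleans m
    Qₘ = booleansMoving m
    1≤N : 1 ≤ N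
    1≤N = s≤s z≤n

  Σχ-booleans-suc : ∀ {j} → j ≤ N → Σχ (booleans N) j ≡ Σχ Bₘ j + Σχ (booleansMoving N) j
  Σχ-booleans-suc {j} j≤N = trans (sum-map-++ (λ w → χ w j) (map (extend N) Bₘ) _)
    (cong₂ _+_ (Σχ-map-preserving (All.map (λ fw → χ-extend fw j≤N) (booleans-fits m))) refl)

  Σχ-booleansMoving-suc : ∀ {j} → j ≤ m → Σχ (booleansMoving N) j ≡ Σχ Bₘ j + Σχ Qₘ j
  Σχ-booleansMoving-suc {j} j≤m = trans (sum-map-++ (λ w → χ w j) (map (swapPositions N) Bₘ) _) (cong₂ _+_
    (Σχ-map-preserving (All.map (λ fw → χ-swapPositions fw 1≤N (s≤s j≤m)) (booleans-fits m)))
    (Σχ-map-preserving (All.map (λ fw → χ-swapValues fw (m≤n⇒m≤1+n j≤m)) (booleansMoving-fits m))))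

  Σχ-booleansMoving-suc-N : Σχ (booleansMoving N) N ≡ Σχ Qₘ N
  Σχ-booleansMoving-suc-N = trans (sum-map-++ (λ w → χ w N) (map (swapPositions N) Bₘ) _) (cong₂ _+_
    (trans (Σχ-map-const (All.map (λ fw → χ-swapPositions-N fw 1≤N) (booleans-fits m))) (*-zeroʳ (length Bₘ)))
    (Σχ-map-preserving (All.map (λ fw → χ-swapValues fw ≤-refl) (booleansMoving-fits m))))

  Σχ-booleans-suc-top : Σχ (booleans N) (suc N) ≡ Σχ (booleansMoving N) (suc N)
  Σχ-booleans-suc-top = trans (sum-map-++ (λ w → χ w (suc N)) (map (extend N) Bₘ) _)
    (cong₂ _+_ (trans (Σχ-map-const (All.map χ-extend-top (booleans-fits m))) (*-zeroʳ (length Bₘ))) refl)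

  Σχ-booleansMoving-suc-top : Σχ (booleansMoving N) (suc N) ≡ length (booleansMoving N)
  Σχ-booleansMoving-suc-top = begin
    Σχ (booleansMoving N) (suc N)                    ≡⟨ sum-map-++ (λ w → χ w (suc N)) (map (swapPositions N) Bₘ) _ ⟩
    Σχ (map (swapPositions N) Bₘ) (suc N) + Σχ (map (swapValues N) Qₘ) (suc N)
      ≡⟨ cong₂ _+_ (Σχ-map-const (All.map (λ fw → χ-swapPositions-top fw 1≤N) (booleans-fits m)))
                   (Σχ-map-const (All.zipWith (λ (fw , moves) → χ-swapValues-top fw moves)
                                              (booleansMoving-fits m , booleansMoving-moves m))) ⟩
    length Bₘ * 1 + length Qₘ * 1                      ≡⟨ cong₂ _+_ (*-identityʳ (length Bₘ)) (*-identityʳ (length Qₘ)) ⟩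
    length Bₘ + length Qₘ                              ≡⟨ length-booleansMoving-suc m ⟨
    length (booleansMoving N)                        ∎
    where open ≡-Reasoning

Σχ-booleansMoving-top : ∀ m → Σχ (booleansMoving m) (suc m) ≡ length (booleansMoving m)
Σχ-booleansMoving-top zero    = refl
Σχ-booleansMoving-top (suc m) = Σχ-booleansMoving-suc-top m

Σχ-booleans-top : ∀ m → Σχ (booleans m) (suc m) ≡ length (booleansMoving m)
Σχ-booleans-top zero    = refl
Σχ-booleans-top (suc m) = trans (Σχ-booleans-suc-top m) (Σχ-booleansMoving-suc-top m)

moving≤booleans : ∀ m → length (booleansMoving m) ≤ length (booleans m)
moving≤booleans zero    = z≤n
moving≤booleans (suc m) = ≤-trans (m≤n+m _ (length (booleans m))) (≤-reflexive (sym (length-booleans-suc m)))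

booleans≤2*moving : ∀ m → length (booleans (suc m)) ≤ 2 * length (booleansMoving (suc m))
booleans≤2*moving m = begin
  length (booleans (suc m))   ≡⟨ length-booleans-suc m ⟩
  length (booleans m) + q′    ≤⟨ +-monoˡ-≤ q′ (≤-trans (m≤m+n _ _) (≤-reflexive (sym (length-booleansMoving-suc m)))) ⟩
  q′ + q′                     ≡⟨ cong (q′ +_) (+-identityʳ q′) ⟨
  2 * q′                      ∎
  where
  open ≤-Reasoning
  q′ = length (booleansMoving (suc m))

3*moving≤2*booleans : ∀ m → 3 * length (booleansMoving m) ≤ 2 * length (booleans m)
3*moving≤2*booleans zero    = z≤n
3*moving≤2*booleans (suc m) = begin
  3 * length (booleansMoving (suc m))  ≡⟨ cong (3 *_) (length-booleansMoving-suc m) ⟩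
  3 * (b + q)                          ≡⟨ regroup₁ b q ⟩
  3 * b + 2 * q + q                    ≤⟨ +-monoʳ-≤ (3 * b + 2 * q) (moving≤booleans m) ⟩
  3 * b + 2 * q + b                    ≡⟨ regroup₂ b q ⟩
  2 * (b + (b + q))                    ≡⟨ cong (λ q′ → 2 * (b + q′)) (length-booleansMoving-suc m) ⟨
  2 * (b + length (booleansMoving (suc m)))  ≡⟨ cong (2 *_) (length-booleans-suc m) ⟨
  2 * length (booleans (suc m))        ∎
  where
  open ≤-Reasoning
  b = length (booleans m)
  q = length (booleansMoving m)
  regroup₁ : ∀ b q → 3 * (b + q) ≡ 3 * b + 2 * q + q
  regroup₁ = solve-∀
  regroup₂ : ∀ b q → 3 * b + 2 * q + b ≡ 2 * (b + (b + q))
  regroup₂ = solve-∀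

Σχ-bound : ∀ m {j} → j ≤ m →
           2 * Σχ (booleans m) j ≤ length (booleans m) × 2 * Σχ (booleansMoving m) j ≤ length (booleansMoving m)
Σχ-bound zero    z≤n = z≤n , z≤n
Σχ-bound (suc m) {j} j≤1+m with m≤n⇒m<n∨m≡n j≤1+m
... | inj₁ j<1+m = booleans-bound , moving-bound
  where
  j≤m = ≤-pred j<1+m
  c = Σχ (booleans m) j
  d′ = Σχ (booleansMoving (suc m)) j
  moving-bound : 2 * d′ ≤ length (booleansMoving (suc m))
  moving-bound = begin
    2 * d′                                              ≡⟨ cong (2 *_) (Σχ-booleansMoving-suc m j≤m) ⟩
    2 * (c + Σχ (booleansMoving m) j)                   ≡⟨ *-distribˡ-+ 2 c _ ⟩
    2 * c + 2 * Σχ (booleansMoving m) j                 ≤⟨ +-mono-≤ (proj₁ (Σχ-bound m j≤m)) (proj₂ (Σχ-bound m j≤m)) ⟩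
    length (booleans m) + length (booleansMoving m)     ≡⟨ length-booleansMoving-suc m ⟨
    length (booleansMoving (suc m))                     ∎
    where open ≤-Reasoning
  booleans-bound : 2 * Σχ (booleans (suc m)) j ≤ length (booleans (suc m))
  booleans-bound = begin
    2 * Σχ (booleans (suc m)) j                         ≡⟨ cong (2 *_) (Σχ-booleans-suc m (m≤n⇒m≤1+n j≤m)) ⟩
    2 * (c + d′)                                        ≡⟨ *-distribˡ-+ 2 c d′ ⟩
    2 * c + 2 * d′                                      ≤⟨ +-mono-≤ (proj₁ (Σχ-bound m j≤m)) moving-bound ⟩
    length (booleans m) + length (booleansMoving (suc m)) ≡⟨ length-booleans-suc m ⟨
    length (booleans (suc m))                           ∎
    where open ≤-Reasoning
... | inj₂ refl = booleans-bound , moving-bound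
  where
  b = length (booleans m)
  q = length (booleansMoving m)
  d′≡q : Σχ (booleansMoving (suc m)) (suc m) ≡ q
  d′≡q = trans (Σχ-booleansMoving-suc-N m) (Σχ-booleansMoving-top m)
  moving-bound : 2 * Σχ (booleansMoving (suc m)) (suc m) ≤ length (booleansMoving (suc m))
  moving-bound = begin
    2 * Σχ (booleansMoving (suc m)) (suc m)   ≡⟨ cong (2 *_) d′≡q ⟩
    q + (q + 0)                               ≡⟨ cong (q +_) (+-identityʳ q) ⟩
    q + q                                     ≤⟨ +-monoˡ-≤ q (moving≤booleans m) ⟩
    b + q                                     ≡⟨ length-booleansMoving-suc m ⟨
    length (booleansMoving (suc m))           ∎
    where open ≤-Reasoning
  booleans-bound : 2 * Σχ (booleans (suc m)) (suc m) ≤ length (booleans (suc m))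
  booleans-bound = begin
    2 * Σχ (booleans (suc m)) (suc m)         ≡⟨ cong (2 *_) (Σχ-booleans-suc m ≤-refl) ⟩
    2 * (Σχ (booleans m) (suc m) + Σχ (booleansMoving (suc m)) (suc m))
                                              ≡⟨ cong₂ (λ c d → 2 * (c + d)) (Σχ-booleans-top m) d′≡q ⟩
    2 * (q + q)                               ≡⟨ regroup₁ q ⟩
    3 * q + q                                 ≤⟨ +-mono-≤ (3*moving≤2*booleans m) ≤-refl ⟩
    2 * b + q                                 ≡⟨ regroup₂ b q ⟩
    b + (b + q)                               ≡⟨ cong (b +_) (length-booleansMoving-suc m) ⟨
    b + length (booleansMoving (suc m))       ≡⟨ length-booleans-suc m ⟨
    length (booleans (suc m))                 ∎
    where
    open ≤-Reasoning
    regroup₁ : ∀ q → 2 * (q + q) ≡ 3 * q + q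
    regroup₁ = solve-∀
    regroup₂ : ∀ b q → 2 * b + q ≡ b + (b + q)
    regroup₂ = solve-∀

module Expectation (k : ℕ) {L : List (List ℕ)} (L↭ : L ↭ booleans (suc k)) where

  private
    m = suc k
    n = suc m
    N = length L
    q = length (booleansMoving m)
    c : ℕ → ℕ
    c = Σχ (booleans m)

  N≡ : N ≡ length (booleans m)
  N≡ = ↭.↭-length L↭

  tailSum : ℕ → ℕ
  tailSum i = sum (map c (range i n))

  Φ : ℕ → ℕ
  Φ i = 2 * tailSum (suc i) + N * i

  SumY-suc : ∀ i → SumY n L (suc i) ≡ N * Φ i
  SumY-suc i = begin
    SumY n L (suc i)
      ≡⟨ cong sum (map-cong (λ u → cong sum (map-cong (λ v → cong (_∸ 1) (+-suc (Λ′ u + Λ′ v) i)) L)) L) ⟩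
    sum (map (λ u → sum (map (λ v → Λ′ u + Λ′ v + i) L)) L)
      ≡⟨ sum-pairs Λ′ i L ⟩
    N * (2 * sum (map Λ′ L) + N * i)
      ≡⟨ cong (λ t → N * (2 * t + N * i)) Λ-total ⟩
    N * Φ i ∎
    where
    open ≡-Reasoning
    Λ′ : List ℕ → ℕ
    Λ′ u = Λ n u (suc i)
    Λ-total : sum (map Λ′ L) ≡ tailSum (suc i)
    Λ-total = trans (sum-map-comm χ L (range (suc i) n))
      (cong sum (map-cong (λ j → sum-↭ (↭.map⁺ (λ w → χ w j) L↭)) (range (suc i) n)))

  tail-cons : ∀ {i} → i ≤ n → tailSum i ≡ c i + tailSum (suc i)
  tail-cons i≤n = cong (sum ∘ map c) (range-cons i≤n)

  tail-end : tailSum (suc n) ≡ 0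
  tail-end = cong (sum ∘ map c) (range-empty n)

  Φ-step : ∀ {i} → i < m → Φ i ≤ Φ (suc i)
  Φ-step {i} i<m = begin
    2 * tailSum (suc i) + N * i                  ≡⟨ cong (λ t → 2 * t + N * i) (tail-cons (m≤n⇒m≤1+n i<m)) ⟩
    2 * (c (suc i) + t) + N * i               ≡⟨ regroup₁ (c (suc i)) t (N * i) ⟩
    2 * t + (N * i + 2 * c (suc i))           ≤⟨ +-monoʳ-≤ (2 * t) (+-monoʳ-≤ (N * i) 2c≤N) ⟩
    2 * t + (N * i + N)                       ≡⟨ regroup₂ t N i ⟩
    2 * t + N * suc i                         ∎
    where
    open ≤-Reasoning
    t = tailSum (suc (suc i))
    2c≤N : 2 * c (suc i) ≤ N
    2c≤N = subst (2 * c (suc i) ≤_) (sym N≡) (proj₁ (Σχ-bound m i<m))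
    regroup₁ : ∀ c t x → 2 * (c + t) + x ≡ 2 * t + (x + 2 * c)
    regroup₁ = solve-∀
    regroup₂ : ∀ t N i → 2 * t + (N * i + N) ≡ 2 * t + N * suc i
    regroup₂ = solve-∀

  Φ-last : Φ m ≡ 2 * q + N * m
  Φ-last = cong (λ t → 2 * t + N * m) (begin
    tailSum n                    ≡⟨ tail-cons ≤-refl ⟩
    c n + tailSum (suc n)        ≡⟨ cong₂ _+_ (Σχ-booleans-top m) tail-end ⟩
    q + 0                     ≡⟨ +-identityʳ q ⟩
    q                         ∎)
    where open ≡-Reasoning

  N≤2q : N ≤ 2 * q
  N≤2q = subst (_≤ 2 * q) (sym N≡) (booleans≤2*moving k)

  q≤N : q ≤ N
  q≤N = subst (q ≤_) (sym N≡) (moving≤booleans m)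

  Φ-max : ∀ {i} → i ≤ n → Φ i ≤ Φ m
  Φ-max i≤n with m≤n⇒m<n∨m≡n i≤n
  ... | inj₁ i<n  = stepwise-≤ Φ Φ-step (≤-pred i<n)
  ... | inj₂ refl = begin
    2 * tailSum (suc n) + N * n  ≡⟨ cong (λ t → 2 * t + N * n) tail-end ⟩
    N * n                     ≡⟨ *-suc N m ⟩
    N + N * m                 ≤⟨ +-monoˡ-≤ (N * m) N≤2q ⟩
    2 * q + N * m             ≡⟨ Φ-last ⟨
    Φ m                       ∎
    where open ≤-Reasoning

  SumY-n : SumY n L n ≡ N * (2 * q + N * m)
  SumY-n = trans (SumY-suc m) (cong (N *_) Φ-last)

  SumY-maximal : ∀ i → 1 ≤ i → i ≤ n + 1 → SumY n L i ≤ SumY n L n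
  SumY-maximal (suc i) _ 1+i≤n+1 = begin
    SumY n L (suc i)  ≡⟨ SumY-suc i ⟩
    N * Φ i           ≤⟨ *-monoʳ-≤ N (Φ-max (≤-pred (subst (suc i ≤_) (+-comm n 1) 1+i≤n+1))) ⟩
    N * Φ m           ≡⟨ SumY-suc m ⟨
    SumY n L n        ∎
    where open ≤-Reasoning

  SumY-lower : n * (N * N) ≤ SumY n L n
  SumY-lower = begin
    n * (N * N)               ≡⟨ regroup N m ⟩
    N * (N + N * m)           ≤⟨ *-monoʳ-≤ N (+-monoˡ-≤ (N * m) N≤2q) ⟩
    N * (2 * q + N * m)       ≡⟨ SumY-n ⟨
    SumY n L n                ∎
    where
    open ≤-Reasoning
    regroup : ∀ N m → suc m * (N * N) ≡ N * (N + N * m)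
    regroup = solve-∀

  SumY-upper : SumY n L n ≤ (n + 1) * (N * N)
  SumY-upper = begin
    SumY n L n                ≡⟨ SumY-n ⟩
    N * (2 * q + N * m)       ≤⟨ *-monoʳ-≤ N (+-monoˡ-≤ (N * m) (*-monoʳ-≤ 2 q≤N)) ⟩
    N * (2 * N + N * m)       ≡⟨ regroup N m ⟩
    (n + 1) * (N * N)         ∎
    where
    open ≤-Reasoning
    regroup : ∀ N m → N * (2 * N + N * m) ≡ (suc m + 1) * (N * N)
    regroup = solve-∀

  SumY-identity : SumY n L n * F (2 * n ∸ 1) + 2 * F (2 * n ∸ 3) * (N * N) ≡ (n + 1) * F (2 * n ∸ 1) * (N * N)
  SumY-identity = begin
    SumY n L n * F (2 * n ∸ 1) + 2 * F (2 * n ∸ 3) * (N * N)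
      ≡⟨ cong₂ _+_ (cong₂ _*_ SumY-n F-2n-1) (cong (λ f → 2 * f * (N * N)) F-2n-3) ⟩
    N * (2 * q + N * m) * N + 2 * b * (N * N)
      ≡⟨ cong (λ x → x * (2 * q + x * m) * x + 2 * b * (x * x)) N≡b+q ⟩
    (b + q) * (2 * q + (b + q) * m) * (b + q) + 2 * b * ((b + q) * (b + q))
      ≡⟨ identity b q m ⟩
    (n + 1) * (b + q) * ((b + q) * (b + q))
      ≡⟨ cong (λ x → (n + 1) * x * (x * x)) N≡b+q ⟨
    (n + 1) * N * (N * N)
      ≡⟨ cong (λ f → (n + 1) * f * (N * N)) F-2n-1 ⟨
    (n + 1) * F (2 * n ∸ 1) * (N * N) ∎
    where
    open ≡-Reasoning
    b = length (booleans k)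
    N≡b+q : N ≡ b + q
    N≡b+q = trans N≡ (length-booleans-suc k)
    F-2n-1 : F (2 * n ∸ 1) ≡ N
    F-2n-1 = trans (cong (F ∘ (_∸ 1)) (*-suc 2 m)) (trans (sym (proj₁ (length-booleans-fib m))) (sym N≡))
    F-2n-3 : F (2 * n ∸ 3) ≡ b
    F-2n-3 = trans (cong (F ∘ (_∸ 3)) (trans (*-suc 2 m) (cong (2 +_) (*-suc 2 k))))
                   (sym (proj₁ (length-booleans-fib k)))
    identity : ∀ b q m → (b + q) * (2 * q + (b + q) * m) * (b + q) + 2 * b * ((b + q) * (b + q))
                       ≡ (suc m + 1) * (b + q) * ((b + q) * (b + q))
    identity = solve-∀

lemma5p20 : (n : ℕ) → 3 ≤ n → (L : List (List ℕ)) → Unique L → (∀ w → (w ∈ L) ⇔ IsBoolean n w) →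
    ((∀ i → 1 ≤ i → i ≤ n + 1 → SumY n L i ≤ SumY n L n)
    × (SumY n L n * F (2 * n ∸ 1) + 2 * F (2 * n ∸ 3) * (length L * length L)
    ≡ (n + 1) * F (2 * n ∸ 1) * (length L * length L))
    × (n * (length L * length L) ≤ SumY n L n)
    × (SumY n L n ≤ (n + 1) * (length L * length L)))
lemma5p20 (suc (suc (suc k))) (s≤s (s≤s (s≤s _))) L uniqueL L⇔B =
  SumY-maximal , SumY-identity , SumY-lower , SumY-upper
  where open Expectation (suc k) (booleans-↭ (suc (suc k)) uniqueL L⇔B)
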